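{- Let $A$ carry an IF-structure in a strict symmetric monoidal $\dagger$-category. Let $\alpha:A\to A$ be a green phase and let $k:A\to A$ be a green-classical map. Then $k\circ\alpha\circ k^\dagger$ is a green phase.
   Context: Work in a strict symmetric monoidal $\dagger$-category (unit $I$, symmetry $\sigma$; $u$ unitary means $u^\dagger u=\mathrm{id}$, $uu^\dagger=\mathrm{id}$). A $\dagger$-SCFA on $A$ is $(\mu,\eta,\delta=\mu^\dagger,\epsilon=\eta^\dagger)$ with $(\mu,\eta)$ a commutative monoid, $(\mu\otimes\mathrm{id})(\mathrm{id}\otimes\delta)=\delta\mu=(\mathrm{id}\otimes\mu)(\delta\otimes\mathrm{id})$, and $\mu\delta=\mathrm{id}_A$. An IF-structure on $A$ is a pair of $\dagger$-SCFAs, green $(\mu_g,\eta_g,\delta_g,\epsilon_g)$ and red $(\mu_r,\eta_r,\delta_r,\epsilon_r)$, with $\delta_g\mu_r=(\mu_r\otimes\mu_r)(\mathrm{id}\otimes\sigma\otimes\mathrm{id})(\delta_g\otimes\delta_g)$, $\delta_g\eta_r=\eta_r\otimes\eta_r$, $\epsilon_g\mu_r=\epsilon_g\otimes\epsilon_g$, $\eta_r=(\epsilon_r\otimes\mathrm{id}_A)\delta_g\eta_g$, $\epsilon_g=\epsilon_r\mu_r(\mathrm{id}_A\otimes\eta_g)$; scalar factors built from $\epsilon_g\eta_r$ accompanying the bialgebra laws are suppressed throughout. A green phase is a unitary $\alpha:A\to A$ with $\mu_g\circ(\alpha\otimes\mathrm{id}_A)=\alpha\circ\mu_g$. A point $\psi:I\to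 A$ is green-set-like if $\delta_g\psi=\psi\otimes\psi$. A green-classical map is a map of the form $k=\mu_r\circ(\psi\otimes\mathrm{id}_A)$ where $\psi$ is green-set-like and $k$ is unitary (so $k$ is a red phase). -}

module Defs where

open import Level using (Level; suc; _⊔_)
open import Relation.Binary.PropositionalEquality using (_≡_; refl; subst; sym)
open import Relation.Binary.Structures using (IsEquivalence)
open import Data.Product using (Σ; _×_; _,_)

-- In a strict monoidal category the associator/unitors are identities,
-- i.e. they are exactly such transports along the object equalities.
coeWith : ∀ {o ℓ} {Obj : Set o} (Hom : Obj → Obj → Set ℓ)
          (idm : ∀ {X} → Hom X X) {X Y : Obj} → X ≡ Y → Hom X Y
coeWith Hom idm {X} p = subst (Hom X) p idm

record StrictSMDaggerCat (o ℓ e : Level) : Set (suc (o ⊔ ℓ ⊔ e)) where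
  infixr 9 _∘_
  infixr 10 _⊗₀_ _⊗₁_
  infix 4 _≈_
  field
    Obj : Set o
    Hom : Obj → Obj → Set ℓ
    _≈_ : ∀ {X Y} → Hom X Y → Hom X Y → Set e
    ≈-equiv : ∀ {X Y} → IsEquivalence (_≈_ {X} {Y})
    id  : ∀ {X} → Hom X X
    _∘_ : ∀ {X Y Z} → Hom Y Z → Hom X Y → Hom X Z
    ∘-resp-≈ : ∀ {X Y Z} {f f' : Hom Y Z} {g g' : Hom X Y} →
               f ≈ f' → g ≈ g' → f ∘ g ≈ f' ∘ g'
    assoc : ∀ {W X Y Z} {f : Hom Y Z} {g : Hom X Y} {h : Hom W X} →
            (f ∘ g) ∘ h ≈ f ∘ (g ∘ h)
    identityˡ : ∀ {X Y} {f : Hom X Y} → id ∘ f ≈ f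
    identityʳ : ∀ {X Y} {f : Hom X Y} → f ∘ id ≈ f
    I    : Obj
    _⊗₀_ : Obj → Obj → Obj
    _⊗₁_ : ∀ {X Y X' Y'} → Hom X Y → Hom X' Y' → Hom (X ⊗₀ X') (Y ⊗₀ Y')
    ⊗-resp-≈ : ∀ {X Y X' Y'} {f f' : Hom X Y} {g g' : Hom X' Y'} →
               f ≈ f' → g ≈ g' → f ⊗₁ g ≈ f' ⊗₁ g'
    ⊗-id : ∀ {X Y} → id {X} ⊗₁ id {Y} ≈ id
    ⊗-∘  : ∀ {X Y Z X' Y' Z'} {f : Hom Y Z} {g : Hom X Y}
             {f' : Hom Y' Z'} {g' : Hom X' Y'} →
           (f ∘ g) ⊗₁ (f' ∘ g') ≈ (f ⊗₁ f') ∘ (g ⊗₁ g')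
    assoc₀  : ∀ {X Y Z} → (X ⊗₀ Y) ⊗₀ Z ≡ X ⊗₀ (Y ⊗₀ Z)
    unitˡ₀  : ∀ {X} → I ⊗₀ X ≡ X
    unitʳ₀  : ∀ {X} → X ⊗₀ I ≡ X
    assoc-nat : ∀ {X Y Z X' Y' Z'} {f : Hom X X'} {g : Hom Y Y'} {h : Hom Z Z'} →
                coeWith Hom id assoc₀ ∘ ((f ⊗₁ g) ⊗₁ h)
                  ≈ (f ⊗₁ (g ⊗₁ h)) ∘ coeWith Hom id assoc₀
    unitˡ-nat : ∀ {X Y} {f : Hom X Y} →
                coeWith Hom id unitˡ₀ ∘ (id {I} ⊗₁ f) ≈ f ∘ coeWith Hom id unitˡ₀
    unitʳ-nat : ∀ {X Y} {f : Hom X Y} →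
                coeWith Hom id unitʳ₀ ∘ (f ⊗₁ id {I}) ≈ f ∘ coeWith Hom id unitʳ₀
    pentagon : ∀ {W X Y Z} →
      (id {W} ⊗₁ coeWith Hom id (assoc₀ {X} {Y} {Z}))
        ∘ coeWith Hom id assoc₀ ∘ (coeWith Hom id assoc₀ ⊗₁ id)
      ≈ coeWith Hom id assoc₀ ∘ coeWith Hom id assoc₀
    triangle : ∀ {X Y} →
      (id {X} ⊗₁ coeWith Hom id (unitˡ₀ {Y})) ∘ coeWith Hom id assoc₀
      ≈ coeWith Hom id unitʳ₀ ⊗₁ id
    σ : ∀ {X Y} → Hom (X ⊗₀ Y) (Y ⊗₀ X)
    σ-nat : ∀ {X Y X' Y'} {f : Hom X X'} {g : Hom Y Y'} →
            σ ∘ (f ⊗₁ g) ≈ (g ⊗₁ f) ∘ σ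
    σ-inv : ∀ {X Y} → σ {Y} {X} ∘ σ {X} {Y} ≈ id
    hexagon : ∀ {X Y Z} →
      coeWith Hom id (assoc₀ {Y} {Z} {X}) ∘ σ {X} {Y ⊗₀ Z}
        ∘ coeWith Hom id (assoc₀ {X} {Y} {Z})
      ≈ (id ⊗₁ σ) ∘ coeWith Hom id assoc₀ ∘ (σ ⊗₁ id)
    _† : ∀ {X Y} → Hom X Y → Hom Y X
    †-resp-≈ : ∀ {X Y} {f g : Hom X Y} → f ≈ g → f † ≈ g †
    †-invol : ∀ {X Y} {f : Hom X Y} → (f †) † ≈ f
    †-id : ∀ {X} → id {X} † ≈ id
    †-∘ : ∀ {X Y Z} {f : Hom Y Z} {g : Hom X Y} → (f ∘ g) † ≈ (g †) ∘ (f †)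
    †-⊗ : ∀ {X Y X' Y'} {f : Hom X Y} {g : Hom X' Y'} → (f ⊗₁ g) † ≈ (f †) ⊗₁ (g †)
    †-σ : ∀ {X Y} → σ {X} {Y} † ≈ σ {Y} {X}
    -- the structural identities are unitary (automatic under K)
    †-assoc : ∀ {X Y Z} → coeWith Hom id (assoc₀ {X} {Y} {Z}) † ≈ coeWith Hom id (sym assoc₀)
    †-unitˡ : ∀ {X} → coeWith Hom id (unitˡ₀ {X}) † ≈ coeWith Hom id (sym unitˡ₀)
    †-unitʳ : ∀ {X} → coeWith Hom id (unitʳ₀ {X}) † ≈ coeWith Hom id (sym unitʳ₀)

  α : ∀ {X Y Z} → Hom ((X ⊗₀ Y) ⊗₀ Z) (X ⊗₀ (Y ⊗₀ Z))
  α = coeWith Hom id assoc₀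
  α⁻¹ : ∀ {X Y Z} → Hom (X ⊗₀ (Y ⊗₀ Z)) ((X ⊗₀ Y) ⊗₀ Z)
  α⁻¹ = coeWith Hom id (sym assoc₀)
  λ' : ∀ {X} → Hom (I ⊗₀ X) X
  λ' = coeWith Hom id unitˡ₀
  λ⁻¹ : ∀ {X} → Hom X (I ⊗₀ X)
  λ⁻¹ = coeWith Hom id (sym unitˡ₀)
  ρ : ∀ {X} → Hom (X ⊗₀ I) X
  ρ = coeWith Hom id unitʳ₀
  ρ⁻¹ : ∀ {X} → Hom X (X ⊗₀ I)
  ρ⁻¹ = coeWith Hom id (sym unitʳ₀)

  unitary : ∀ {X Y} → Hom X Y → Set e
  unitary u = ((u †) ∘ u ≈ id) × (u ∘ (u †) ≈ id)

module _ {o ℓ e} (C : StrictSMDaggerCat o ℓ e) where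
  open StrictSMDaggerCat C

  record IsDaggerSCFA (A : Obj) (μ : Hom (A ⊗₀ A) A) (η : Hom I A) : Set e where
    δ : Hom A (A ⊗₀ A)
    δ = μ †
    ε : Hom A I
    ε = η †
    field
      unitL : μ ∘ (η ⊗₁ id) ∘ λ⁻¹ ≈ id
      unitR : μ ∘ (id ⊗₁ η) ∘ ρ⁻¹ ≈ id
      assocM : μ ∘ (μ ⊗₁ id) ≈ μ ∘ (id ⊗₁ μ) ∘ α
      commM : μ ∘ σ ≈ μ
      frobL : (μ ⊗₁ id) ∘ α⁻¹ ∘ (id ⊗₁ δ) ≈ δ ∘ μ
      frobR : (id ⊗₁ μ) ∘ α ∘ (δ ⊗₁ id) ≈ δ ∘ μ
      special : μ ∘ δ ≈ id

  -- the map id_A ⊗ σ ⊗ id_A on (A⊗A)⊗(A⊗A)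
  middleSwap : (A : Obj) → Hom ((A ⊗₀ A) ⊗₀ (A ⊗₀ A)) ((A ⊗₀ A) ⊗₀ (A ⊗₀ A))
  middleSwap A = α⁻¹ ∘ (id ⊗₁ (α ∘ (σ ⊗₁ id) ∘ α⁻¹)) ∘ α

  -- an IF-structure on A: green and red †-SCFAs satisfying the listed laws
  -- (scalar factors suppressed, as in the paper)
  record IFStructure (A : Obj) : Set (ℓ ⊔ e) where
    field
      μg : Hom (A ⊗₀ A) A
      ηg : Hom I A
      μr : Hom (A ⊗₀ A) A
      ηr : Hom I A
      green : IsDaggerSCFA A μg ηg
      red   : IsDaggerSCFA A μr ηr
    δg : Hom A (A ⊗₀ A)
    δg = μg †
    εg : Hom A I
    εg = ηg †
    δr : Hom A (A ⊗₀ A)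
    δr = μr †
    εr : Hom A I
    εr = ηr †
    field
      bialg-μδ : δg ∘ μr ≈ (μr ⊗₁ μr) ∘ middleSwap A ∘ (δg ⊗₁ δg)
      bialg-ηδ : δg ∘ ηr ≈ (ηr ⊗₁ ηr) ∘ λ⁻¹
      bialg-με : εg ∘ μr ≈ λ' ∘ (εg ⊗₁ εg)
      ηr-def : ηr ≈ λ' ∘ (εr ⊗₁ id) ∘ δg ∘ ηg
      εg-def : εg ≈ εr ∘ μr ∘ (id ⊗₁ ηg) ∘ ρ⁻¹

  module _ {A : Obj} (F : IFStructure A) where
    open IFStructure F

    IsGreenPhase : Hom A A → Set e
    IsGreenPhase a = unitary a × (μg ∘ (a ⊗₁ id) ≈ a ∘ μg)

    IsGreenSetLike : Hom I A → Set e
    IsGreenSetLike ψ = δg ∘ ψ ≈ (ψ ⊗₁ ψ) ∘ λ⁻¹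

    IsGreenClassical : Hom A A → Set (ℓ ⊔ e)
    IsGreenClassical k =
      Σ (Hom I A) λ ψ → IsGreenSetLike ψ × (k ≈ μr ∘ (ψ ⊗₁ id) ∘ λ⁻¹) × unitary k

module Submission where

-- A green-classical map k = μr ∘ (ψ ⊗ id) ∘ λ⁻¹ is "left translation by the
-- green-set-like point ψ" in the red monoid.  The red/green bialgebra law
-- together with δg ψ = ψ ⊗ ψ shows that such a translation is a green
-- comonoid homomorphism: δg ∘ k = (k ⊗ k) ∘ δg.  Taking daggers, k† is a
-- green monoid homomorphism, and since k is unitary its inverse k is one too.
-- Finally, conjugating a μg-equivariant map a by a pair of mutually inverse
-- μg-homomorphisms yields a μg-equivariant map, and conjugating a unitary by
-- a unitary yields a unitary.

open import Level using (_⊔_)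
open import Relation.Binary.PropositionalEquality using (_≡_; refl; trans; sym; cong₂)
open import Relation.Binary.Structures using (IsEquivalence)
open import Relation.Binary.Bundles using (Setoid)
open import Data.Product using (Σ; _,_; proj₁; proj₂)
import Relation.Binary.Reasoning.Setoid as SetoidReasoning
open import Defs

module _ {o ℓ e} (C : StrictSMDaggerCat o ℓ e) where
  open StrictSMDaggerCat C

  homSetoid : Obj → Obj → Setoid ℓ e
  homSetoid X Y = record { Carrier = Hom X Y ; _≈_ = _≈_ ; isEquivalence = ≈-equiv }

  private
    module HomReasoning {X Y : Obj} = SetoidReasoning (homSetoid X Y)
  open HomReasoning

  refl≈ : ∀ {X Y} {f : Hom X Y} → f ≈ f
  refl≈ = IsEquivalence.refl ≈-equiv

  sym≈ : ∀ {X Y} {f g : Hom X Y} → f ≈ g → g ≈ f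
  sym≈ = IsEquivalence.sym ≈-equiv

  trans≈ : ∀ {X Y} {f g h : Hom X Y} → f ≈ g → g ≈ h → f ≈ h
  trans≈ = IsEquivalence.trans ≈-equiv

  infixr 5 _⟩∘⟨_ _⟩⊗⟨_
  _⟩∘⟨_ : ∀ {X Y Z} {f f' : Hom Y Z} {g g' : Hom X Y} → f ≈ f' → g ≈ g' → f ∘ g ≈ f' ∘ g'
  _⟩∘⟨_ = ∘-resp-≈

  _⟩⊗⟨_ : ∀ {X Y X' Y'} {f f' : Hom X Y} {g g' : Hom X' Y'} → f ≈ f' → g ≈ g' → f ⊗₁ g ≈ f' ⊗₁ g'
  _⟩⊗⟨_ = ⊗-resp-≈

  pullˡ : ∀ {W X Y Z} {a : Hom Y Z} {b : Hom X Y} {c : Hom X Z} {f : Hom W X} →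
          a ∘ b ≈ c → a ∘ b ∘ f ≈ c ∘ f
  pullˡ ab = trans≈ (sym≈ assoc) (ab ⟩∘⟨ refl≈)

  pullʳ : ∀ {W X Y Z} {a : Hom X Y} {b : Hom W X} {c : Hom W Y} {f : Hom Y Z} →
          a ∘ b ≈ c → (f ∘ a) ∘ b ≈ f ∘ c
  pullʳ ab = trans≈ assoc (refl≈ ⟩∘⟨ ab)

  cancelˡ : ∀ {X Y Z} {a : Hom Y X} {b : Hom X Y} {f : Hom Z X} →
            a ∘ b ≈ id → a ∘ b ∘ f ≈ f
  cancelˡ ab = trans≈ (pullˡ ab) identityˡ

  cancelʳ : ∀ {X Y Z} {a : Hom Y X} {b : Hom X Y} {f : Hom X Z} →
            a ∘ b ≈ id → (f ∘ a) ∘ b ≈ f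
  cancelʳ ab = trans≈ (pullʳ ab) identityʳ

  ⊗-square : ∀ {X₁ X₂ Y₁ Y₂ Z₁ Z₂ W₁ W₂}
               {a : Hom Y₁ Z₁} {x : Hom X₁ Y₁} {y : Hom W₁ Z₁} {a' : Hom X₁ W₁}
               {b : Hom Y₂ Z₂} {w : Hom X₂ Y₂} {z : Hom W₂ Z₂} {b' : Hom X₂ W₂} →
             a ∘ x ≈ y ∘ a' → b ∘ w ≈ z ∘ b' →
             (a ⊗₁ b) ∘ (x ⊗₁ w) ≈ (y ⊗₁ z) ∘ (a' ⊗₁ b')
  ⊗-square sq₁ sq₂ = trans≈ (sym≈ ⊗-∘) (trans≈ (sq₁ ⟩⊗⟨ sq₂) ⊗-∘)

  slide : ∀ {W X Y Y' Z} {a : Hom Y Z} {b : Hom X Y} {c : Hom Y' Z} {d : Hom X Y'} {f : Hom W X} →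
          a ∘ b ≈ c ∘ d → a ∘ b ∘ f ≈ c ∘ d ∘ f
  slide ab = trans≈ (pullˡ ab) assoc

  id-square : ∀ {X Y} {f : Hom X Y} → id ∘ f ≈ f ∘ id
  id-square = trans≈ identityˡ (sym≈ identityʳ)

  nat-∘ : ∀ {X₁ X₂ X₃ Y₁ Y₂ Y₃}
            {c₁ : Hom X₁ X₂} {c₂ : Hom X₂ X₃} {d₁ : Hom Y₁ Y₂} {d₂ : Hom Y₂ Y₃}
            {f : Hom Y₁ X₁} {f' : Hom Y₂ X₂} {f'' : Hom Y₃ X₃} →
          c₂ ∘ f' ≈ f'' ∘ d₂ → c₁ ∘ f ≈ f' ∘ d₁ → (c₂ ∘ c₁) ∘ f ≈ f'' ∘ d₂ ∘ d₁
  nat-∘ sq₂ sq₁ = trans≈ (pullʳ sq₁) (trans≈ (sym≈ assoc) (trans≈ (sq₂ ⟩∘⟨ refl≈) assoc))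

  -- In a strict monoidal category α, λ', ρ and their inverses are of this
  -- form, and coherence reduces to the fact that parallel structural maps
  -- are equal (uniqueness of identity proofs).

  transport : ∀ {X Y} → X ≡ Y → Hom X Y
  transport = coeWith Hom id

  Structural : ∀ {X Y} → Hom X Y → Set (o ⊔ e)
  Structural {X} {Y} f = Σ (X ≡ Y) λ p → f ≈ transport p

  transport-∘ : ∀ {X Y Z} (p : Y ≡ Z) (q : X ≡ Y) → transport p ∘ transport q ≈ transport (trans q p)
  transport-∘ refl refl = identityˡ

  transport-⊗ : ∀ {X Y X' Y'} (p : X ≡ Y) (q : X' ≡ Y') →
                transport p ⊗₁ transport q ≈ transport (cong₂ _⊗₀_ p q)
  transport-⊗ refl refl = ⊗-id

  transport-unique : ∀ {X Y} (p q : X ≡ Y) → transport p ≈ transport q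
  transport-unique refl refl = refl≈

  structural : ∀ {X Y} (p : X ≡ Y) → Structural (transport p)
  structural p = p , refl≈

  structural-id : ∀ {X} → Structural (id {X})
  structural-id = structural refl

  structural-∘ : ∀ {X Y Z} {f : Hom Y Z} {g : Hom X Y} → Structural f → Structural g → Structural (f ∘ g)
  structural-∘ (p , f≈) (q , g≈) = trans q p , trans≈ (f≈ ⟩∘⟨ g≈) (transport-∘ p q)

  structural-⊗ : ∀ {X Y X' Y'} {f : Hom X Y} {g : Hom X' Y'} →
                 Structural f → Structural g → Structural (f ⊗₁ g)
  structural-⊗ (p , f≈) (q , g≈) = cong₂ _⊗₀_ p q , trans≈ (f≈ ⟩⊗⟨ g≈) (transport-⊗ p q)

  coherence : ∀ {X Y} {f g : Hom X Y} → Structural f → Structural g → f ≈ g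
  coherence (p , f≈) (q , g≈) = trans≈ f≈ (trans≈ (transport-unique p q) (sym≈ g≈))

  structural-inverse : ∀ {X Y} {f : Hom X Y} → Structural f → Hom Y X
  structural-inverse (p , _) = transport (sym p)

  structural-inverse-structural : ∀ {X Y} {f : Hom X Y} (s : Structural f) →
                                  Structural (structural-inverse s)
  structural-inverse-structural (p , _) = structural (sym p)

  structural-inverseˡ : ∀ {X Y} {f : Hom X Y} (s : Structural f) → structural-inverse s ∘ f ≈ id
  structural-inverseˡ s = coherence (structural-∘ (structural-inverse-structural s) s) structural-id

  structural-inverseʳ : ∀ {X Y} {f : Hom X Y} (s : Structural f) → f ∘ structural-inverse s ≈ id
  structural-inverseʳ s = coherence (structural-∘ s (structural-inverse-structural s)) structural-id

  cancel-structural : ∀ {X X' Y Y'} {P P' : Hom Y Y'} {Q Q' : Hom X' X} {f g : Hom X Y} →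
                      Structural P → Structural P' → Structural Q → Structural Q' →
                      P ∘ f ∘ Q ≈ P' ∘ g ∘ Q' → f ≈ g
  cancel-structural {P = P} {P'} {Q} {Q'} {f} {g} sP sP' sQ sQ' eq = begin
    f                       ≈⟨ sym≈ (cancelˡ (structural-inverseˡ sP)) ⟩
    P⁻ ∘ P ∘ f              ≈⟨ refl≈ ⟩∘⟨ refl≈ ⟩∘⟨ sym≈ (cancelʳ (structural-inverseʳ sQ)) ⟩
    P⁻ ∘ P ∘ (f ∘ Q) ∘ Q⁻   ≈⟨ refl≈ ⟩∘⟨ sym≈ assoc ⟩
    P⁻ ∘ (P ∘ f ∘ Q) ∘ Q⁻   ≈⟨ refl≈ ⟩∘⟨ eq ⟩∘⟨ refl≈ ⟩
    P⁻ ∘ (P' ∘ g ∘ Q') ∘ Q⁻ ≈⟨ refl≈ ⟩∘⟨ assoc ⟩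
    P⁻ ∘ P' ∘ (g ∘ Q') ∘ Q⁻ ≈⟨ pullˡ (coherence (structural-∘ (structural-inverse-structural sP) sP') structural-id) ⟩
    id ∘ (g ∘ Q') ∘ Q⁻      ≈⟨ identityˡ ⟩
    (g ∘ Q') ∘ Q⁻           ≈⟨ pullʳ (coherence (structural-∘ sQ' (structural-inverse-structural sQ)) structural-id) ⟩
    g ∘ id                  ≈⟨ identityʳ ⟩
    g                       ∎
    where
    P⁻ = structural-inverse sP
    Q⁻ = structural-inverse sQ

  α⁻¹-nat : ∀ {X Y Z X' Y' Z'} {f : Hom X X'} {g : Hom Y Y'} {h : Hom Z Z'} →
            α⁻¹ ∘ (f ⊗₁ (g ⊗₁ h)) ≈ ((f ⊗₁ g) ⊗₁ h) ∘ α⁻¹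
  α⁻¹-nat {f = f} {g} {h} = begin
    α⁻¹ ∘ (f ⊗₁ (g ⊗₁ h))             ≈⟨ sym≈ (cancelʳ (structural-inverseʳ (structural assoc₀))) ⟩
    ((α⁻¹ ∘ (f ⊗₁ (g ⊗₁ h))) ∘ α) ∘ α⁻¹ ≈⟨ pullʳ refl≈ ⟩∘⟨ refl≈ ⟩
    (α⁻¹ ∘ (f ⊗₁ (g ⊗₁ h)) ∘ α) ∘ α⁻¹   ≈⟨ (refl≈ ⟩∘⟨ sym≈ assoc-nat) ⟩∘⟨ refl≈ ⟩
    (α⁻¹ ∘ α ∘ ((f ⊗₁ g) ⊗₁ h)) ∘ α⁻¹   ≈⟨ cancelˡ (structural-inverseˡ (structural assoc₀)) ⟩∘⟨ refl≈ ⟩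
    ((f ⊗₁ g) ⊗₁ h) ∘ α⁻¹               ∎

  λ⁻¹-nat : ∀ {X Y} {f : Hom X Y} → λ⁻¹ ∘ f ≈ (id {I} ⊗₁ f) ∘ λ⁻¹
  λ⁻¹-nat {f = f} = begin
    λ⁻¹ ∘ f                      ≈⟨ refl≈ ⟩∘⟨ sym≈ (cancelʳ (structural-inverseʳ (structural unitˡ₀))) ⟩
    λ⁻¹ ∘ (f ∘ λ') ∘ λ⁻¹         ≈⟨ refl≈ ⟩∘⟨ sym≈ unitˡ-nat ⟩∘⟨ refl≈ ⟩
    λ⁻¹ ∘ (λ' ∘ (id ⊗₁ f)) ∘ λ⁻¹ ≈⟨ refl≈ ⟩∘⟨ assoc ⟩
    λ⁻¹ ∘ λ' ∘ (id ⊗₁ f) ∘ λ⁻¹   ≈⟨ cancelˡ (structural-inverseˡ (structural unitˡ₀)) ⟩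
    (id ⊗₁ f) ∘ λ⁻¹              ∎

  unitˡ-conj : ∀ {X Y} {f : Hom X Y} → id {I} ⊗₁ f ≈ λ⁻¹ ∘ f ∘ λ'
  unitˡ-conj {f = f} = trans≈ (sym≈ (cancelˡ (structural-inverseˡ (structural unitˡ₀))))
                              (refl≈ ⟩∘⟨ unitˡ-nat)

  unitʳ-conj : ∀ {X Y} {f : Hom X Y} → f ⊗₁ id {I} ≈ ρ⁻¹ ∘ f ∘ ρ
  unitʳ-conj {f = f} = trans≈ (sym≈ (cancelˡ (structural-inverseˡ (structural unitʳ₀))))
                              (refl≈ ⟩∘⟨ unitʳ-nat)

  -- The hexagon at (X, I, I),
  -- after rewriting id ⊗ σ and σ ⊗ id by the unitors and σ_{X,I⊗I} by
  -- naturality, gives σ ∘ M ∘ σ = σ for the structural M below; invertibility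
  -- of σ then forces σ_{I,X} = M.
  σ-unit-structural : ∀ {X} → Structural (σ {I} {X})
  σ-unit-structural {X} = proj₁ structural-M , trans≈ t≈M (proj₂ structural-M)
    where
    s : Hom (X ⊗₀ I) (I ⊗₀ X)
    s = σ
    t : Hom (I ⊗₀ X) (X ⊗₀ I)
    t = σ
    M : Hom (I ⊗₀ X) (X ⊗₀ I)
    M = λ' ∘ α ∘ ρ⁻¹
    structural-M : Structural M
    structural-M = structural-∘ (structural unitˡ₀) (structural-∘ (structural assoc₀) (structural (sym unitʳ₀)))
    λ⊗id : Structural (λ' {I} ⊗₁ id {X})
    λ⊗id = structural-⊗ (structural unitˡ₀) structural-id
    σ-I⊗I : σ {X} {I ⊗₀ I} ≈ structural-inverse λ⊗id ∘ s ∘ (id ⊗₁ λ')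
    σ-I⊗I = begin
      σ                                          ≈⟨ sym≈ (cancelˡ (structural-inverseˡ λ⊗id)) ⟩
      structural-inverse λ⊗id ∘ (λ' ⊗₁ id) ∘ σ    ≈⟨ refl≈ ⟩∘⟨ sym≈ σ-nat ⟩
      structural-inverse λ⊗id ∘ s ∘ (id ⊗₁ λ')    ∎
    regroup : λ' ∘ α ∘ ρ⁻¹ ∘ s ∘ ρ ≈ (M ∘ s) ∘ ρ
    regroup = begin
      λ' ∘ α ∘ ρ⁻¹ ∘ s ∘ ρ    ≈⟨ refl≈ ⟩∘⟨ refl≈ ⟩∘⟨ sym≈ assoc ⟩
      λ' ∘ α ∘ (ρ⁻¹ ∘ s) ∘ ρ  ≈⟨ refl≈ ⟩∘⟨ sym≈ assoc ⟩
      λ' ∘ (α ∘ ρ⁻¹ ∘ s) ∘ ρ  ≈⟨ sym≈ assoc ⟩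
      (λ' ∘ α ∘ ρ⁻¹ ∘ s) ∘ ρ  ≈⟨ sym≈ (trans≈ assoc (refl≈ ⟩∘⟨ assoc)) ⟩∘⟨ refl≈ ⟩
      (M ∘ s) ∘ ρ             ∎
    s≈sMs : s ≈ s ∘ M ∘ s
    s≈sMs = cancel-structural
      (structural-∘ (structural assoc₀) (structural-inverse-structural λ⊗id))
      (structural (sym unitˡ₀))
      (structural-∘ (structural-⊗ structural-id (structural unitˡ₀)) (structural assoc₀))
      (structural unitʳ₀)
      (begin
        (α ∘ structural-inverse λ⊗id) ∘ s ∘ (id ⊗₁ λ') ∘ α ≈⟨ assoc ⟩
        α ∘ structural-inverse λ⊗id ∘ s ∘ (id ⊗₁ λ') ∘ α   ≈⟨ refl≈ ⟩∘⟨ refl≈ ⟩∘⟨ sym≈ assoc ⟩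
        α ∘ structural-inverse λ⊗id ∘ (s ∘ (id ⊗₁ λ')) ∘ α ≈⟨ refl≈ ⟩∘⟨ sym≈ assoc ⟩
        α ∘ (structural-inverse λ⊗id ∘ s ∘ (id ⊗₁ λ')) ∘ α ≈⟨ refl≈ ⟩∘⟨ sym≈ σ-I⊗I ⟩∘⟨ refl≈ ⟩
        α ∘ σ ∘ α                                           ≈⟨ hexagon ⟩
        (id ⊗₁ s) ∘ α ∘ (s ⊗₁ id)                           ≈⟨ unitˡ-conj ⟩∘⟨ refl≈ ⟩∘⟨ unitʳ-conj ⟩
        (λ⁻¹ ∘ s ∘ λ') ∘ α ∘ ρ⁻¹ ∘ s ∘ ρ                   ≈⟨ pullʳ assoc ⟩
        λ⁻¹ ∘ s ∘ λ' ∘ α ∘ ρ⁻¹ ∘ s ∘ ρ                     ≈⟨ refl≈ ⟩∘⟨ refl≈ ⟩∘⟨ regroup ⟩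
        λ⁻¹ ∘ s ∘ (M ∘ s) ∘ ρ                              ≈⟨ refl≈ ⟩∘⟨ sym≈ assoc ⟩
        λ⁻¹ ∘ (s ∘ M ∘ s) ∘ ρ                              ∎)
    Ms≈id : M ∘ s ≈ id
    Ms≈id = begin
      M ∘ s          ≈⟨ sym≈ (cancelˡ σ-inv) ⟩
      t ∘ s ∘ M ∘ s  ≈⟨ refl≈ ⟩∘⟨ sym≈ s≈sMs ⟩
      t ∘ s          ≈⟨ σ-inv ⟩
      id             ∎
    t≈M : t ≈ M
    t≈M = begin
      t            ≈⟨ sym≈ identityˡ ⟩
      id ∘ t       ≈⟨ sym≈ Ms≈id ⟩∘⟨ refl≈ ⟩
      (M ∘ s) ∘ t  ≈⟨ cancelʳ σ-inv ⟩
      M            ∎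

  -- The middle-four interchange (X ⊗ Y) ⊗ (Z ⊗ W) → (X ⊗ Z) ⊗ (Y ⊗ W);
  -- at X = Y = Z = W = A it is, by definition, middleSwap C A.
  middleFour : ∀ {X Y Z W} → Hom ((X ⊗₀ Y) ⊗₀ (Z ⊗₀ W)) ((X ⊗₀ Z) ⊗₀ (Y ⊗₀ W))
  middleFour = α⁻¹ ∘ (id ⊗₁ (α ∘ (σ ⊗₁ id) ∘ α⁻¹)) ∘ α

  middleFour-nat : ∀ {X Y Z W X' Y' Z' W'}
                     {f : Hom X X'} {g : Hom Y Y'} {h : Hom Z Z'} {l : Hom W W'} →
                   middleFour ∘ ((f ⊗₁ g) ⊗₁ (h ⊗₁ l)) ≈ ((f ⊗₁ h) ⊗₁ (g ⊗₁ l)) ∘ middleFour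
  middleFour-nat = nat-∘ α⁻¹-nat (nat-∘ (⊗-square id-square inner-nat) assoc-nat)
    where
    inner-nat : ∀ {Y Z W Y' Z' W'} {g : Hom Y Y'} {h : Hom Z Z'} {l : Hom W W'} →
                (α ∘ (σ ⊗₁ id) ∘ α⁻¹) ∘ (g ⊗₁ (h ⊗₁ l)) ≈ (h ⊗₁ (g ⊗₁ l)) ∘ α ∘ (σ ⊗₁ id) ∘ α⁻¹
    inner-nat = nat-∘ assoc-nat (nat-∘ (⊗-square σ-nat id-square) α⁻¹-nat)

  -- On unit factors the interchange is structural; this is where the
  -- symmetry σ : I ⊗ X → X ⊗ I being structural is needed.
  middleFour-unit : ∀ {X Y} → middleFour ∘ (λ⁻¹ ⊗₁ id) ∘ λ⁻¹ ≈ λ⁻¹ {X} ⊗₁ λ⁻¹ {Y}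
  middleFour-unit = coherence
    (structural-∘ middleFour-structural
      (structural-∘ (structural-⊗ (structural (sym unitˡ₀)) structural-id) (structural (sym unitˡ₀))))
    (structural-⊗ (structural (sym unitˡ₀)) (structural (sym unitˡ₀)))
    where
    middleFour-structural : ∀ {X Y} → Structural (middleFour {I} {I} {X} {Y})
    middleFour-structural = structural-∘ (structural (sym assoc₀))
      (structural-∘ (structural-⊗ structural-id
        (structural-∘ (structural assoc₀)
          (structural-∘ (structural-⊗ σ-unit-structural structural-id) (structural (sym assoc₀)))))
        (structural assoc₀))

  translate : ∀ {A} → Hom (A ⊗₀ A) A → Hom I A → Hom A A
  translate μ ψ = μ ∘ (ψ ⊗₁ id) ∘ λ⁻¹

  translate-comonoid-hom : ∀ {A} {μ : Hom (A ⊗₀ A) A} {δ : Hom A (A ⊗₀ A)} {ψ : Hom I A} →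
    δ ∘ μ ≈ (μ ⊗₁ μ) ∘ middleFour ∘ (δ ⊗₁ δ) →
    δ ∘ ψ ≈ (ψ ⊗₁ ψ) ∘ λ⁻¹ →
    δ ∘ translate μ ψ ≈ (translate μ ψ ⊗₁ translate μ ψ) ∘ δ
  translate-comonoid-hom {μ = μ} {δ} {ψ} bialgebra set-like = begin
    δ ∘ μ ∘ (ψ ⊗₁ id) ∘ λ⁻¹
      ≈⟨ pullˡ bialgebra ⟩
    ((μ ⊗₁ μ) ∘ middleFour ∘ (δ ⊗₁ δ)) ∘ (ψ ⊗₁ id) ∘ λ⁻¹
      ≈⟨ pullʳ (pullʳ copy-ψ) ⟩
    (μ ⊗₁ μ) ∘ middleFour ∘ ((ψ ⊗₁ ψ) ⊗₁ (id ⊗₁ id)) ∘ (λ⁻¹ ⊗₁ id) ∘ λ⁻¹ ∘ δ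
      ≈⟨ refl≈ ⟩∘⟨ slide middleFour-nat ⟩
    (μ ⊗₁ μ) ∘ ((ψ ⊗₁ id) ⊗₁ (ψ ⊗₁ id)) ∘ middleFour ∘ (λ⁻¹ ⊗₁ id) ∘ λ⁻¹ ∘ δ
      ≈⟨ refl≈ ⟩∘⟨ refl≈ ⟩∘⟨ trans≈ (refl≈ ⟩∘⟨ sym≈ assoc) (pullˡ middleFour-unit) ⟩
    (μ ⊗₁ μ) ∘ ((ψ ⊗₁ id) ⊗₁ (ψ ⊗₁ id)) ∘ (λ⁻¹ ⊗₁ λ⁻¹) ∘ δ
      ≈⟨ sym≈ (trans≈ ((trans≈ ⊗-∘ (refl≈ ⟩∘⟨ ⊗-∘)) ⟩∘⟨ refl≈) (trans≈ assoc (refl≈ ⟩∘⟨ assoc))) ⟩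
    (translate μ ψ ⊗₁ translate μ ψ) ∘ δ
      ∎
    where
    copy-ψ : (δ ⊗₁ δ) ∘ (ψ ⊗₁ id) ∘ λ⁻¹ ≈ ((ψ ⊗₁ ψ) ⊗₁ (id ⊗₁ id)) ∘ (λ⁻¹ ⊗₁ id) ∘ λ⁻¹ ∘ δ
    copy-ψ = begin
      (δ ⊗₁ δ) ∘ (ψ ⊗₁ id) ∘ λ⁻¹                              ≈⟨ pullˡ (sym≈ ⊗-∘) ⟩
      ((δ ∘ ψ) ⊗₁ (δ ∘ id)) ∘ λ⁻¹                              ≈⟨ (set-like ⟩⊗⟨ δ-id) ⟩∘⟨ refl≈ ⟩
      (((ψ ⊗₁ ψ) ∘ λ⁻¹) ⊗₁ ((id ⊗₁ id) ∘ δ)) ∘ λ⁻¹             ≈⟨ trans≈ (⊗-∘ ⟩∘⟨ refl≈) assoc ⟩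
      ((ψ ⊗₁ ψ) ⊗₁ (id ⊗₁ id)) ∘ (λ⁻¹ ⊗₁ δ) ∘ λ⁻¹              ≈⟨ refl≈ ⟩∘⟨ split-λ⁻¹⊗δ ⟩∘⟨ refl≈ ⟩
      ((ψ ⊗₁ ψ) ⊗₁ (id ⊗₁ id)) ∘ ((λ⁻¹ ⊗₁ id) ∘ (id ⊗₁ δ)) ∘ λ⁻¹ ≈⟨ refl≈ ⟩∘⟨ trans≈ assoc (refl≈ ⟩∘⟨ sym≈ λ⁻¹-nat) ⟩
      ((ψ ⊗₁ ψ) ⊗₁ (id ⊗₁ id)) ∘ (λ⁻¹ ⊗₁ id) ∘ λ⁻¹ ∘ δ         ∎
      where
      δ-id : δ ∘ id ≈ (id ⊗₁ id) ∘ δ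
      δ-id = trans≈ identityʳ (sym≈ (trans≈ (⊗-id ⟩∘⟨ refl≈) identityˡ))
      split-λ⁻¹⊗δ : λ⁻¹ {I} ⊗₁ δ ≈ (λ⁻¹ ⊗₁ id) ∘ (id ⊗₁ δ)
      split-λ⁻¹⊗δ = trans≈ (sym≈ identityʳ ⟩⊗⟨ sym≈ identityˡ) ⊗-∘

  dagger-monoid-hom : ∀ {A} {μ : Hom (A ⊗₀ A) A} {k : Hom A A} →
                      (μ †) ∘ k ≈ (k ⊗₁ k) ∘ (μ †) → μ ∘ ((k †) ⊗₁ (k †)) ≈ (k †) ∘ μ
  dagger-monoid-hom {μ = μ} {k} comonoid-hom = begin
    μ ∘ ((k †) ⊗₁ (k †))        ≈⟨ sym≈ †-invol ⟩∘⟨ sym≈ †-⊗ ⟩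
    ((μ †) †) ∘ ((k ⊗₁ k) †)    ≈⟨ sym≈ †-∘ ⟩
    ((k ⊗₁ k) ∘ (μ †)) †        ≈⟨ †-resp-≈ (sym≈ comonoid-hom) ⟩
    ((μ †) ∘ k) †               ≈⟨ †-∘ ⟩
    (k †) ∘ ((μ †) †)           ≈⟨ refl≈ ⟩∘⟨ †-invol ⟩
    (k †) ∘ μ                   ∎

  inverse-monoid-hom : ∀ {A} {μ : Hom (A ⊗₀ A) A} {f g : Hom A A} →
                       g ∘ f ≈ id → f ∘ g ≈ id → μ ∘ (g ⊗₁ g) ≈ g ∘ μ → μ ∘ (f ⊗₁ f) ≈ f ∘ μ
  inverse-monoid-hom {μ = μ} {f} {g} gf fg g-hom = begin
    μ ∘ (f ⊗₁ f)                 ≈⟨ sym≈ (cancelˡ fg) ⟩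
    f ∘ g ∘ μ ∘ (f ⊗₁ f)         ≈⟨ refl≈ ⟩∘⟨ slide (sym≈ g-hom) ⟩
    f ∘ μ ∘ (g ⊗₁ g) ∘ (f ⊗₁ f)  ≈⟨ refl≈ ⟩∘⟨ refl≈ ⟩∘⟨ sym≈ ⊗-∘ ⟩
    f ∘ μ ∘ ((g ∘ f) ⊗₁ (g ∘ f)) ≈⟨ refl≈ ⟩∘⟨ refl≈ ⟩∘⟨ trans≈ (gf ⟩⊗⟨ gf) ⊗-id ⟩
    f ∘ μ ∘ id                   ≈⟨ refl≈ ⟩∘⟨ identityʳ ⟩
    f ∘ μ                        ∎

  conjugate-equivariant : ∀ {A} {μ : Hom (A ⊗₀ A) A} {f g a : Hom A A} →
    μ ∘ (f ⊗₁ f) ≈ f ∘ μ → μ ∘ (g ⊗₁ g) ≈ g ∘ μ → f ∘ g ≈ id →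
    μ ∘ (a ⊗₁ id) ≈ a ∘ μ → μ ∘ ((f ∘ a ∘ g) ⊗₁ id) ≈ (f ∘ a ∘ g) ∘ μ
  conjugate-equivariant {μ = μ} {f} {g} {a} f-hom g-hom fg a-equivariant = begin
    μ ∘ ((f ∘ a ∘ g) ⊗₁ id)      ≈⟨ refl≈ ⟩∘⟨ (refl≈ ⟩⊗⟨ sym≈ fg) ⟩
    μ ∘ ((f ∘ a ∘ g) ⊗₁ (f ∘ g)) ≈⟨ refl≈ ⟩∘⟨ ⊗-∘ ⟩
    μ ∘ (f ⊗₁ f) ∘ ((a ∘ g) ⊗₁ g) ≈⟨ slide f-hom ⟩
    f ∘ μ ∘ ((a ∘ g) ⊗₁ g)       ≈⟨ refl≈ ⟩∘⟨ refl≈ ⟩∘⟨ trans≈ (refl≈ ⟩⊗⟨ sym≈ identityˡ) ⊗-∘ ⟩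
    f ∘ μ ∘ (a ⊗₁ id) ∘ (g ⊗₁ g) ≈⟨ refl≈ ⟩∘⟨ slide a-equivariant ⟩
    f ∘ a ∘ μ ∘ (g ⊗₁ g)         ≈⟨ refl≈ ⟩∘⟨ refl≈ ⟩∘⟨ g-hom ⟩
    f ∘ a ∘ g ∘ μ                ≈⟨ sym≈ (trans≈ assoc (refl≈ ⟩∘⟨ assoc)) ⟩
    (f ∘ a ∘ g) ∘ μ              ∎

  conjugate-∘ : ∀ {A} {k x y : Hom A A} → (k †) ∘ k ≈ id →
                (k ∘ x ∘ (k †)) ∘ (k ∘ y ∘ (k †)) ≈ k ∘ (x ∘ y) ∘ (k †)
  conjugate-∘ {k = k} {x} {y} k†k = begin
    (k ∘ x ∘ (k †)) ∘ k ∘ y ∘ (k †) ≈⟨ pullʳ (pullʳ (cancelˡ k†k)) ⟩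
    k ∘ x ∘ y ∘ (k †)               ≈⟨ refl≈ ⟩∘⟨ sym≈ assoc ⟩
    k ∘ (x ∘ y) ∘ (k †)             ∎

  conjugate-id : ∀ {A} {k x : Hom A A} → k ∘ (k †) ≈ id → x ≈ id → k ∘ x ∘ (k †) ≈ id
  conjugate-id kk† x≈id = trans≈ (refl≈ ⟩∘⟨ trans≈ (x≈id ⟩∘⟨ refl≈) identityˡ) kk†

  conjugate-† : ∀ {A} {k x : Hom A A} → (k ∘ x ∘ (k †)) † ≈ k ∘ (x †) ∘ (k †)
  conjugate-† {k = k} {x} = begin
    (k ∘ x ∘ (k †)) †         ≈⟨ †-∘ ⟩
    (x ∘ (k †)) † ∘ (k †)     ≈⟨ †-∘ ⟩∘⟨ refl≈ ⟩
    ((k †) † ∘ (x †)) ∘ (k †) ≈⟨ pullʳ refl≈ ⟩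
    (k †) † ∘ (x †) ∘ (k †)   ≈⟨ †-invol ⟩∘⟨ refl≈ ⟩
    k ∘ (x †) ∘ (k †)         ∎

  conjugate-unitary : ∀ {A} {k a : Hom A A} → unitary k → unitary a → unitary (k ∘ a ∘ (k †))
  conjugate-unitary (k†k , kk†) (a†a , aa†) =
    trans≈ (conjugate-† ⟩∘⟨ refl≈) (trans≈ (conjugate-∘ k†k) (conjugate-id kk† a†a)) ,
    trans≈ (refl≈ ⟩∘⟨ conjugate-†) (trans≈ (conjugate-∘ k†k) (conjugate-id kk† aa†))

theorem9 : ∀ {o ℓ e} (C : StrictSMDaggerCat o ℓ e) →
    let open StrictSMDaggerCat C in
    {A : Obj} (F : IFStructure C A) (a k : Hom A A) →
    IsGreenPhase C F a → IsGreenClassical C F k →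
    IsGreenPhase C F (k ∘ a ∘ (k †))
theorem9 C F a k (a-unitary , a-equivariant) (ψ , ψ-set-like , k≈translate , k-unitary@(k†k , kk†)) =
  conjugate-unitary C k-unitary a-unitary ,
  conjugate-equivariant C k-monoid-hom k†-monoid-hom kk† a-equivariant
  where
  open StrictSMDaggerCat C
  open IFStructure F

  k-comonoid-hom : δg ∘ k ≈ (k ⊗₁ k) ∘ δg
  k-comonoid-hom =
    trans≈ C (∘-resp-≈ (refl≈ C) k≈translate)
      (trans≈ C (translate-comonoid-hom C bialg-μδ ψ-set-like)
        (∘-resp-≈ (⊗-resp-≈ (sym≈ C k≈translate) (sym≈ C k≈translate)) (refl≈ C)))

  k†-monoid-hom : μg ∘ ((k †) ⊗₁ (k †)) ≈ (k †) ∘ μg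
  k†-monoid-hom = dagger-monoid-hom C k-comonoid-hom

  k-monoid-hom : μg ∘ (k ⊗₁ k) ≈ k ∘ μg
  k-monoid-hom = inverse-monoid-hom C k†k kk† k†-monoid-hom
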